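{- Let $G_B=(V_B,E_B)$ be a graph with $n=|V_B|$ even, and let $G=(V,E)$ be the graph obtained from $G_B$ by adding a set $V_c$ of $n$ new vertices forming a clique and joining every vertex of $V_B$ to every vertex of $V_c$ (so $V=V_c\cup V_B$). Let $G_1=G[V_1]$, $G_2=G[V_2]$ be an optimal solution of {\sf 2-Overlapping Densest Subgraphs} on $G$ with $\alpha=\frac23$. Then $V_1\cup V_2=V$.
   Context: Graphs are finite, simple, undirected; density of a graph with $n'\ge1$ vertices and $m'$ edges is $m'/n'$. A feasible solution of {\sf 2-Overlapping Densest Subgraphs} on $G$ with parameter $\alpha$ is a pair of induced subgraphs $G[V_1]$, $G[V_2]$ with $V_1,V_2$ nonempty, $V_1\neq V_2$, $|V_1\cap V_2|\le\alpha|V_1|$ and $|V_1\cap V_2|\le\alpha|V_2|$; its value is $density(G[V_1])+density(G[V_2])$, and an optimal solution is a feasible solution of maximum value. -}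

module Defs where

open import Data.Bool using (Bool; true; false; if_then_else_; _∧_; not)
open import Data.Nat using (ℕ; zero; suc; _<ᵇ_; _+_)
open import Data.Nat.Divisibility using (_∣_)
open import Data.Fin using (Fin; toℕ; splitAt; _≟_)
open import Data.Fin.Subset using (Subset; Nonempty; ∣_∣; _∩_)
open import Data.Vec using (lookup)
open import Data.List using (List; map; allFin)
open import Data.Nat.ListAction using (sum)
open import Data.Sum using (inj₁; inj₂)
open import Data.Product using (_×_)
open import Data.Integer using (+_)
open import Data.Rational using (ℚ; 0ℚ; _≤_) renaming (_/_ to _÷_; _+_ to _+ℚ_; _*_ to _*ℚ_)
open import Relation.Nullary using (¬_; does)
open import Relation.Binary.PropositionalEquality using (_≡_; refl) renaming (sym to ≡-sym)
import Relation.Nullary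
import Data.Empty

record SimpleGraph (N : ℕ) : Set where
  field
    adj    : Fin N → Fin N → Bool
    sym    : ∀ i j → adj i j ≡ adj j i
    irrefl : ∀ i → adj i i ≡ false
open SimpleGraph public

edges : ∀ {N} → SimpleGraph N → Subset N → ℕ
edges {N} G S = sum (map (λ i → sum (map (λ j →
  if (toℕ i <ᵇ toℕ j) ∧ lookup S i ∧ lookup S j ∧ adj G i j then 1 else 0)
  (allFin N))) (allFin N))

-- m / k as a rational (0 when k = 0; only used for nonempty vertex sets).
divℕ : ℕ → ℕ → ℚ
divℕ m zero    = 0ℚ
divℕ m (suc k) = (+ m) ÷ (suc k)

density : ∀ {N} → SimpleGraph N → Subset N → ℚ
density G S = divℕ (edges G S) ∣ S ∣

nat : ℕ → ℚ
nat m = (+ m) ÷ 1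

Feasible : ∀ {N} → SimpleGraph N → ℚ → Subset N → Subset N → Set
Feasible G α V₁ V₂ =
  Nonempty V₁ × Nonempty V₂ × ¬ (V₁ ≡ V₂) ×
  (nat ∣ V₁ ∩ V₂ ∣ ≤ α *ℚ nat ∣ V₁ ∣) × (nat ∣ V₁ ∩ V₂ ∣ ≤ α *ℚ nat ∣ V₂ ∣)

value : ∀ {N} → SimpleGraph N → Subset N → Subset N → ℚ
value G V₁ V₂ = density G V₁ +ℚ density G V₂

Optimal : ∀ {N} → SimpleGraph N → ℚ → Subset N → Subset N → Set
Optimal G α V₁ V₂ =
  Feasible G α V₁ V₂ ×
  (∀ W₁ W₂ → Feasible G α W₁ W₂ → value G W₁ W₂ ≤ value G V₁ V₂)

-- G from G_B: vertices Fin (n + n); the first n form V_c (a clique),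
-- the last n are V_B (a copy of G_B); every V_c vertex is joined to every V_B vertex.
cliqueJoinAdj : ∀ {n} → SimpleGraph n → Fin (n + n) → Fin (n + n) → Bool
cliqueJoinAdj {n} GB x y with splitAt n x | splitAt n y
... | inj₁ i | inj₁ j = not (does (i ≟ j))
... | inj₁ i | inj₂ j = true
... | inj₂ i | inj₁ j = true
... | inj₂ i | inj₂ j = adj GB i j

cliqueJoinSym : ∀ {n} (GB : SimpleGraph n) → ∀ x y → cliqueJoinAdj GB x y ≡ cliqueJoinAdj GB y x
cliqueJoinSym {n} GB x y with splitAt n x | splitAt n y
... | inj₁ i | inj₁ j with i ≟ j | j ≟ i
...   | Relation.Nullary.yes _ | Relation.Nullary.yes _ = refl
...   | Relation.Nullary.no _  | Relation.Nullary.no _  = refl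
...   | Relation.Nullary.yes p | Relation.Nullary.no q  = Data.Empty.⊥-elim (q (≡-sym p))
...   | Relation.Nullary.no p  | Relation.Nullary.yes q = Data.Empty.⊥-elim (p (≡-sym q))
cliqueJoinSym {n} GB x y | inj₁ i | inj₂ j = refl
cliqueJoinSym {n} GB x y | inj₂ i | inj₁ j = refl
cliqueJoinSym {n} GB x y | inj₂ i | inj₂ j = SimpleGraph.sym GB i j

cliqueJoinIrrefl : ∀ {n} (GB : SimpleGraph n) → ∀ x → cliqueJoinAdj GB x x ≡ false
cliqueJoinIrrefl {n} GB x with splitAt n x
... | inj₁ i with i ≟ i
...   | Relation.Nullary.yes _ = refl
...   | Relation.Nullary.no q = Data.Empty.⊥-elim (q refl)
cliqueJoinIrrefl {n} GB x | inj₂ i = irrefl GB i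

cliqueJoin : ∀ {n} → SimpleGraph n → SimpleGraph (n + n)
cliqueJoin GB = record { adj = cliqueJoinAdj GB ; sym = cliqueJoinSym GB ; irrefl = cliqueJoinIrrefl GB }

module Submission where

-- Adding an uncovered vertex x to V₁ leaves the overlap unchanged, so by optimality it cannot
-- raise the density of V₁; as G[V₁] has at most |V₁|(|V₁|-1)/2 edges, this forces
-- 2·deg_{V₁}(x) + 1 ≤ |V₁|. A clique vertex is adjacent to all of V₁, which is absurd. An
-- uncovered base vertex is adjacent to the whole clique, so each Vₖ would have fewer clique than
-- base vertices. The clique being covered, the base parts of V₁ and V₂ then have more than n
-- vertices in total and share a vertex y, while some clique vertex x lies in V₂ ∖ V₁. Replacing
-- y by x in V₁ preserves sizes and overlap and cannot lower the density, since x sees everything;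
-- so the solution stays optimal with one more clique vertex in V₁, and n such exchanges would
-- give V₁ more than n clique vertices.

import Algebra.Properties.CommutativeMonoid.Sum as Sum
open import Data.Bool using (Bool; true; false; if_then_else_; _∧_; _∨_)
open import Data.Bool.Properties using (∧-zeroʳ; ∧-identityʳ)
open import Data.Empty using (⊥; ⊥-elim)
open import Data.Fin using (Fin; zero; suc; toℕ; _≟_; _↑ˡ_; _↑ʳ_; splitAt)
import Data.Fin.Properties as Fin
open import Data.Fin.Properties
  using (toℕ-injective; ↑ˡ-injective; splitAt-↑ˡ; splitAt-↑ʳ; splitAt⁻¹-↑ˡ; splitAt⁻¹-↑ʳ)
open import Data.Fin.Subset using (Subset; ∣_∣; _∩_; _∪_; ⊤; _∈_; Nonempty)
open import Data.Fin.Subset.Properties using (∩-comm; ⊆-antisym; ⊆⊤)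
open import Data.Integer as ℤ using (+_)
import Data.Integer.Properties as ℤ
import Data.List as List using (map; tabulate)
open import Data.Nat using (ℕ; zero; suc; _+_; _*_; _≤_; _<_; z≤n; s≤s; _<ᵇ_; NonZero)
open import Data.Nat.Divisibility using (_∣_)
import Data.Nat.ListAction as List
open import Data.Nat.Properties hiding (_≟_)
open import Data.Nat.Tactic.RingSolver using (solve-∀)
open import Data.Product using (∃; _×_; _,_; proj₁; map)
open import Data.Rational as ℚ using (ℚ; _/_)
import Data.Rational.Properties as ℚ
import Data.Rational.Unnormalised as ℚᵘ
import Data.Rational.Unnormalised.Properties as ℚᵘ
open import Data.Sum using (inj₁; inj₂)
open import Data.Vec using (_∷_; []; lookup; _[_]≔_)
open import Data.Vec.Properties
  using (lookup∘update; lookup∘update′; []≔-idempotent; []≔-lookup; lookup-zipWith; []=⇒lookup; lookup⇒[]=)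
open import Function using (_∘_; id)
open import Relation.Binary.PropositionalEquality
open import Relation.Nullary using (¬_; yes; no; does)
open import Relation.Nullary.Reflects using (ofʸ; ofⁿ)

open import Defs hiding (sym)

open Sum +-0-commutativeMonoid using (sum; sum-cong-≗; ∑-distrib-+; ∑-comm)

ind : Bool → ℕ
ind b = if b then 1 else 0

ind≤1 : ∀ b → ind b ≤ 1
ind≤1 true  = s≤s z≤n
ind≤1 false = z≤n

sum-mono-≤ : ∀ {m} {f g : Fin m → ℕ} → (∀ i → f i ≤ g i) → sum f ≤ sum g
sum-mono-≤ {zero}  f≤g = z≤n
sum-mono-≤ {suc m} f≤g = +-mono-≤ (f≤g zero) (sum-mono-≤ (f≤g ∘ suc))

sum-zero : ∀ {m} {f : Fin m → ℕ} → (∀ i → f i ≡ 0) → sum f ≡ 0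
sum-zero {zero}  f≡0 = refl
sum-zero {suc m} f≡0 = cong₂ _+_ (f≡0 zero) (sum-zero (f≡0 ∘ suc))

sum-ones : ∀ m → sum {m} (λ _ → 1) ≡ m
sum-ones zero    = refl
sum-ones (suc m) = cong suc (sum-ones m)

sum-distrib-+₃ : ∀ {m} (f g h : Fin m → ℕ) → sum (λ i → f i + g i + h i) ≡ sum f + sum g + sum h
sum-distrib-+₃ f g h = trans (∑-distrib-+ (λ i → f i + g i) h) (cong (_+ sum h) (∑-distrib-+ f g))

sum-↑ : ∀ m n (f : Fin (m + n) → ℕ) → sum f ≡ sum (f ∘ (_↑ˡ n)) + sum (f ∘ (m ↑ʳ_))
sum-↑ zero    n f = refl
sum-↑ (suc m) n f = trans (cong (_+_ (f zero)) (sum-↑ m n (f ∘ suc))) (sym (+-assoc (f zero) _ _))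

sum-map-tabulate : ∀ {A : Set} {m} (f : A → ℕ) (g : Fin m → A) →
  List.sum (List.map f (List.tabulate g)) ≡ sum (f ∘ g)
sum-map-tabulate {m = zero}  f g = refl
sum-map-tabulate {m = suc m} f g = cong (_+_ (f (g zero))) (sum-map-tabulate f (g ∘ suc))

δ : ∀ {m} → Fin m → ℕ → Fin m → ℕ
δ x c i = if does (i ≟ x) then c else 0

sum-δ : ∀ {m} (x : Fin m) c → sum (δ x c) ≡ c
sum-δ {suc m} zero    c = trans (cong (_+_ c) (sum-zero {m} (λ _ → refl))) (+-identityʳ c)
sum-δ {suc m} (suc x) c = trans (sum-cong-≗ {m} shift) (sum-δ x c)
  where
  shift : ∀ i → δ (suc x) c (suc i) ≡ δ x c i
  shift i with i ≟ x
  ... | yes _ = refl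
  ... | no  _ = refl

count : ∀ {m} → (Fin m → Bool) → ℕ
count p = sum (ind ∘ p)

count≤ : ∀ {m} (p : Fin m → Bool) → count p ≤ m
count≤ {m} p = subst (count p ≤_) (sum-ones m) (sum-mono-≤ (ind≤1 ∘ p))

count≡0⇒false : ∀ {m} (p : Fin m → Bool) → count p ≡ 0 → ∀ i → p i ≡ false
count≡0⇒false p c≡0 zero    with p zero | c≡0
... | false | _ = refl
count≡0⇒false p c≡0 (suc i) = count≡0⇒false (p ∘ suc) (m+n≡0⇒n≡0 (ind (p zero)) c≡0) i

0<count⇒∃true : ∀ {m} (p : Fin m → Bool) → 0 < count p → ∃ λ i → p i ≡ true
0<count⇒∃true {suc m} p 0<c with p zero in p₀
... | true  = zero , p₀
... | false = map suc id (0<count⇒∃true (p ∘ suc) 0<c)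

count<⇒∃false : ∀ {m} (p : Fin m → Bool) → count p < m → ∃ λ i → p i ≡ false
count<⇒∃false {suc m} p c<m with p zero in p₀
... | false = zero , p₀
... | true  = map suc id (count<⇒∃false (p ∘ suc) (≤-pred c<m))

count-overlap : ∀ {m} (p q : Fin m → Bool) → m < count p + count q → ∃ λ i → p i ≡ true × q i ≡ true
count-overlap {suc m} p q m<cp+cq with p zero in p₀ | q zero in q₀
... | true  | true  = zero , p₀ , q₀
... | true  | false = map suc id (count-overlap (p ∘ suc) (q ∘ suc) (≤-pred m<cp+cq))
... | false | true  = map suc id (count-overlap (p ∘ suc) (q ∘ suc) (≤-pred (subst (suc m <_) (+-suc _ _) m<cp+cq)))
... | false | false = map suc id (count-overlap (p ∘ suc) (q ∘ suc) (<-trans (n<1+n m) m<cp+cq))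

count-cover : ∀ {m} (p q : Fin m → Bool) → (∀ i → p i ∨ q i ≡ true) → m ≤ count p + count q
count-cover {m} p q covered = begin
  m                                   ≡⟨ sum-ones m ⟨
  sum {m} (λ _ → 1)                   ≤⟨ sum-mono-≤ (λ i → ∨⇒1≤ (p i) (q i) (covered i)) ⟩
  sum (λ i → ind (p i) + ind (q i))   ≡⟨ ∑-distrib-+ (ind ∘ p) (ind ∘ q) ⟩
  count p + count q                   ∎
  where
  open ≤-Reasoning
  ∨⇒1≤ : ∀ a b → a ∨ b ≡ true → 1 ≤ ind a + ind b
  ∨⇒1≤ true  _    _ = s≤s z≤n
  ∨⇒1≤ false true _ = s≤s z≤n

count-insert : ∀ {m} (p q : Fin m → Bool) {i} → p i ≡ false → q i ≡ true →
  (∀ k → k ≢ i → q k ≡ p k) → count q ≡ suc (count p)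
count-insert {suc m} p q {zero}  p₀ q₀ q≗p rewrite p₀ | q₀ =
  cong suc (sum-cong-≗ (λ k → cong ind (q≗p (suc k) λ ())))
count-insert {suc m} p q {suc i} pᵢ qᵢ q≗p rewrite q≗p zero (λ ()) =
  trans (cong (_+_ (ind (p zero)))
              (count-insert (p ∘ suc) (q ∘ suc) pᵢ qᵢ (λ k k≢i → q≗p (suc k) (k≢i ∘ Fin.suc-injective))))
        (+-suc (ind (p zero)) _)

2[e+d]+1+k≤[1+k]² : ∀ e d k → 2 * e + k ≤ k * k → d ≤ k → 2 * (e + d) + suc k ≤ suc k * suc k
2[e+d]+1+k≤[1+k]² e d k 2e+k≤k² d≤k = begin
  2 * (e + d) + suc k        ≡⟨ regroup e d k ⟩
  (2 * e + k) + (2 * d + 1)  ≤⟨ +-mono-≤ 2e+k≤k² (+-monoˡ-≤ 1 (*-monoʳ-≤ 2 d≤k)) ⟩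
  k * k + (2 * k + 1)        ≡⟨ square-suc k ⟩
  suc k * suc k              ∎
  where
  open ≤-Reasoning
  regroup : ∀ e d k → 2 * (e + d) + suc k ≡ (2 * e + k) + (2 * d + 1)
  regroup = solve-∀
  square-suc : ∀ k → k * k + (2 * k + 1) ≡ suc k * suc k
  square-suc = solve-∀

[e+d]*s≤e*[1+s]⇒d*s≤e : ∀ e d s → (e + d) * s ≤ e * suc s → d * s ≤ e
[e+d]*s≤e*[1+s]⇒d*s≤e e d s h =
  +-cancelˡ-≤ (e * s) (d * s) e (subst₂ _≤_ (*-distribʳ-+ s e d) (trans (*-suc e s) (+-comm e (e * s))) h)

d*s≤e⇒2d+1≤s : ∀ e d s → .{{NonZero s}} → d * s ≤ e → 2 * e + s ≤ s * s → 2 * d + 1 ≤ s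
d*s≤e⇒2d+1≤s e d s ds≤e 2e+s≤s² = *-cancelʳ-≤ (2 * d + 1) s s (begin
  (2 * d + 1) * s  ≡⟨ expand d s ⟩
  2 * (d * s) + s  ≤⟨ +-monoˡ-≤ s (*-monoʳ-≤ 2 ds≤e) ⟩
  2 * e + s        ≤⟨ 2e+s≤s² ⟩
  s * s            ∎)
  where
  open ≤-Reasoning
  expand : ∀ d s → (2 * d + 1) * s ≡ 2 * (d * s) + s
  expand = solve-∀

2*k+1≰k : ∀ k → ¬ 2 * k + 1 ≤ k
2*k+1≰k k h = n≮n k (≤-trans (s≤s (m≤m+n k (k + 0))) (subst (_≤ k) (+-comm (2 * k) 1) h))

2*c+1≤c+b⇒c<b : ∀ c b → 2 * c + 1 ≤ c + b → c < b
2*c+1≤c+b⇒c<b c b h = +-cancelˡ-≤ c (suc c) b (subst (_≤ c + b) (split c) h)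
  where
  split : ∀ c → 2 * c + 1 ≡ c + suc c
  split = solve-∀

toℚᵘ-divℕ : ∀ a k → ℚ.toℚᵘ (divℕ a (suc k)) ℚᵘ.≃ ℚᵘ.mkℚᵘ (+ a) k
toℚᵘ-divℕ a k = ℚ.toℚᵘ-fromℚᵘ (ℚᵘ.mkℚᵘ (+ a) k)

divℕ-≤⇒*-≤ : ∀ a k b l → divℕ a (suc k) ℚ.≤ divℕ b (suc l) → a * suc l ≤ b * suc k
divℕ-≤⇒*-≤ a k b l p
  with ℚᵘ.≤-respʳ-≃ (toℚᵘ-divℕ b l) (ℚᵘ.≤-respˡ-≃ (toℚᵘ-divℕ a k) (ℚ.toℚᵘ-mono-≤ p))
... | ℚᵘ.*≤* q = ℤ.drop‿+≤+ (subst₂ ℤ._≤_ (sym (ℤ.pos-* a (suc l))) (sym (ℤ.pos-* b (suc k))) q)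

*-≤⇒divℕ-≤ : ∀ a k b l → a * suc l ≤ b * suc k → divℕ a (suc k) ℚ.≤ divℕ b (suc l)
*-≤⇒divℕ-≤ a k b l p = ℚ.toℚᵘ-cancel-≤
  (ℚᵘ.≤-respˡ-≃ (ℚᵘ.≃-sym (toℚᵘ-divℕ a k)) (ℚᵘ.≤-respʳ-≃ (ℚᵘ.≃-sym (toℚᵘ-divℕ b l))
    (ℚᵘ.*≤* (subst₂ ℤ._≤_ (ℤ.pos-* a (suc l)) (ℤ.pos-* b (suc k)) (ℤ.+≤+ p)))))

divℕ-monoˡ-≤ : ∀ {a b} k → a ≤ b → divℕ a k ℚ.≤ divℕ b k
divℕ-monoˡ-≤         zero    _   = ℚ.≤-refl
divℕ-monoˡ-≤ {a} {b} (suc k) a≤b = *-≤⇒divℕ-≤ a k b k (*-monoˡ-≤ (suc k) a≤b)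

nat-mono-≤ : ∀ {a b} → a ≤ b → nat a ℚ.≤ nat b
nat-mono-≤ = divℕ-monoˡ-≤ 1

ℚ-+-cancelʳ-≤ : ∀ p q r → p ℚ.+ r ℚ.≤ q ℚ.+ r → p ℚ.≤ q
ℚ-+-cancelʳ-≤ p q r p+r≤q+r with p ℚ.≤? q
... | yes p≤q = p≤q
... | no  p≰q = ⊥-elim (ℚ.<-irrefl refl (ℚ.<-≤-trans (ℚ.+-monoˡ-< r (ℚ.≰⇒> p≰q)) p+r≤q+r))

∣∣≡count : ∀ {m} (S : Subset m) → ∣ S ∣ ≡ count (lookup S)
∣∣≡count []          = refl
∣∣≡count (true ∷ S)  = cong suc (∣∣≡count S)
∣∣≡count (false ∷ S) = ∣∣≡count S

lookup-∩ : ∀ {m} (S T : Subset m) x → lookup (S ∩ T) x ≡ lookup S x ∧ lookup T x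
lookup-∩ S T x = lookup-zipWith _∧_ x S T

absent-after-remove : ∀ {m} (S : Subset m) {x} y → lookup S x ≡ false → lookup (S [ y ]≔ false) x ≡ false
absent-after-remove S {x} y Sx with x ≟ y
... | yes refl = lookup∘update x S false
... | no x≢y   = trans (lookup∘update′ x≢y S false) Sx

distinct-elements : ∀ {m} (S : Subset m) {x y} → lookup S x ≡ false → lookup S y ≡ true → x ≢ y
distinct-elements S Sx Sy refl with () ← trans (sym Sx) Sy

distinct-subsets : ∀ {m} {S T : Subset m} x → lookup S x ≡ true → lookup T x ≡ false → S ≢ T
distinct-subsets x Sx Tx refl with () ← trans (sym Sx) Tx

∨-cover : ∀ {a b} → (a ≡ false → b ≡ false → ⊥) → a ∨ b ≡ true
∨-cover {true}          _         = refl
∨-cover {false} {true}  _         = refl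
∨-cover {false} {false} uncovered = ⊥-elim (uncovered refl refl)

∪-cover : ∀ {m} (S T : Subset m) x → (lookup S x ≡ false → lookup T x ≡ false → ⊥) → x ∈ S ∪ T
∪-cover S T x uncovered = lookup⇒[]= x (S ∪ T) (trans (lookup-zipWith _∨_ x S T) (∨-cover uncovered))

∣p[x]≔true∣≡suc∣p∣ : ∀ {m} (S : Subset m) x → lookup S x ≡ false → ∣ S [ x ]≔ true ∣ ≡ suc ∣ S ∣
∣p[x]≔true∣≡suc∣p∣ (false ∷ S) zero    _  = refl
∣p[x]≔true∣≡suc∣p∣ (true ∷ S)  (suc x) Sx = cong suc (∣p[x]≔true∣≡suc∣p∣ S x Sx)
∣p[x]≔true∣≡suc∣p∣ (false ∷ S) (suc x) Sx = ∣p[x]≔true∣≡suc∣p∣ S x Sx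

p[x]≔false[x]≔true≡p : ∀ {m} (S : Subset m) x → lookup S x ≡ true → (S [ x ]≔ false) [ x ]≔ true ≡ S
p[x]≔false[x]≔true≡p S x Sx = begin
  (S [ x ]≔ false) [ x ]≔ true  ≡⟨ []≔-idempotent S x ⟩
  S [ x ]≔ true                 ≡⟨ cong (S [ x ]≔_) Sx ⟨
  S [ x ]≔ lookup S x           ≡⟨ []≔-lookup S x ⟩
  S                             ∎
  where open ≡-Reasoning

suc∣p[x]≔false∣≡∣p∣ : ∀ {m} (S : Subset m) x → lookup S x ≡ true → suc ∣ S [ x ]≔ false ∣ ≡ ∣ S ∣
suc∣p[x]≔false∣≡∣p∣ S x Sx =
  trans (sym (∣p[x]≔true∣≡suc∣p∣ (S [ x ]≔ false) x (lookup∘update x S false)))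
        (cong ∣_∣ (p[x]≔false[x]≔true≡p S x Sx))

nonempty⇒∣∣≡suc : ∀ {m} (S : Subset m) → Nonempty S → ∃ λ k → ∣ S ∣ ≡ suc k
nonempty⇒∣∣≡suc S (x , x∈S) = ∣ S [ x ]≔ false ∣ , sym (suc∣p[x]≔false∣≡∣p∣ S x ([]=⇒lookup x∈S))

p[x]≔b∩q : ∀ {m} (S T : Subset m) x b → (S [ x ]≔ b) ∩ T ≡ (S ∩ T) [ x ]≔ (b ∧ lookup T x)
p[x]≔b∩q (_ ∷ S) (_ ∷ T) zero    b = refl
p[x]≔b∩q (s ∷ S) (t ∷ T) (suc x) b = cong ((s ∧ t) ∷_) (p[x]≔b∩q S T x b)

p[x]≔true∩q≡p∩q : ∀ {m} (S T : Subset m) {x} → lookup T x ≡ false → (S [ x ]≔ true) ∩ T ≡ S ∩ T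
p[x]≔true∩q≡p∩q S T {x} Tx = begin
  (S [ x ]≔ true) ∩ T              ≡⟨ p[x]≔b∩q S T x true ⟩
  (S ∩ T) [ x ]≔ lookup T x        ≡⟨ cong ((S ∩ T) [ x ]≔_) (trans Tx (sym [S∩T]x≡false)) ⟩
  (S ∩ T) [ x ]≔ lookup (S ∩ T) x  ≡⟨ []≔-lookup (S ∩ T) x ⟩
  S ∩ T                            ∎
  where
  open ≡-Reasoning
  [S∩T]x≡false : lookup (S ∩ T) x ≡ false
  [S∩T]x≡false = trans (lookup-∩ S T x) (trans (cong (lookup S x ∧_) Tx) (∧-zeroʳ (lookup S x)))

exchange : ∀ {m} → Subset m → Fin m → Fin m → Subset m
exchange S y x = (S [ y ]≔ false) [ x ]≔ true

lookup-exchange-in : ∀ {m} (S : Subset m) y x → lookup (exchange S y x) x ≡ true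
lookup-exchange-in S y x = lookup∘update x (S [ y ]≔ false) true

lookup-exchange-out : ∀ {m} (S : Subset m) {y x} → y ≢ x → lookup (exchange S y x) y ≡ false
lookup-exchange-out S {y} y≢x = trans (lookup∘update′ y≢x (S [ y ]≔ false) true) (lookup∘update y S false)

lookup-exchange-other : ∀ {m} (S : Subset m) {y x z} → z ≢ x → z ≢ y → lookup (exchange S y x) z ≡ lookup S z
lookup-exchange-other S {y} z≢x z≢y =
  trans (lookup∘update′ z≢x (S [ y ]≔ false) true) (lookup∘update′ z≢y S false)

∣exchange∣ : ∀ {m} (S : Subset m) {x y} → lookup S x ≡ false → lookup S y ≡ true →
  ∣ exchange S y x ∣ ≡ ∣ S ∣
∣exchange∣ S {x} {y} Sx Sy =
  trans (∣p[x]≔true∣≡suc∣p∣ (S [ y ]≔ false) x (absent-after-remove S y Sx)) (suc∣p[x]≔false∣≡∣p∣ S y Sy)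

exchange-∩ : ∀ {m} (S T : Subset m) {x} y → lookup T x ≡ true → exchange S y x ∩ T ≡ exchange (S ∩ T) y x
exchange-∩ S T {x} y Tx = begin
  ((S [ y ]≔ false) [ x ]≔ true) ∩ T        ≡⟨ p[x]≔b∩q (S [ y ]≔ false) T x true ⟩
  ((S [ y ]≔ false) ∩ T) [ x ]≔ lookup T x  ≡⟨ cong₂ _[ x ]≔_ (p[x]≔b∩q S T y false) Tx ⟩
  ((S ∩ T) [ y ]≔ false) [ x ]≔ true        ∎
  where open ≡-Reasoning

-- Edges and degrees in an induced subgraph

<ᵇ-irrefl : ∀ n → (n <ᵇ n) ≡ false
<ᵇ-irrefl zero    = refl
<ᵇ-irrefl (suc n) = <ᵇ-irrefl n

module _ {M} (G : SimpleGraph M) where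

  deg : Subset M → Fin M → ℕ
  deg S x = count (λ j → lookup S j ∧ adj G x j)

  deg≤∣∣ : ∀ S x → deg S x ≤ ∣ S ∣
  deg≤∣∣ S x = subst (deg S x ≤_) (sym (∣∣≡count S)) (sum-mono-≤ ind-∧≤)
    where
    ind-∧≤ : ∀ j → ind (lookup S j ∧ adj G x j) ≤ ind (lookup S j)
    ind-∧≤ j with lookup S j
    ... | true  = ind≤1 (adj G x j)
    ... | false = z≤n

  pair : Subset M → Fin M → Fin M → ℕ
  pair S i j = ind ((toℕ i <ᵇ toℕ j) ∧ lookup S i ∧ lookup S j ∧ adj G i j)

  edges≡∑∑pair : ∀ S → edges G S ≡ sum (λ i → sum (λ j → pair S i j))
  edges≡∑∑pair S = trans (sum-map-tabulate {m = M} _ id)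
                         (sum-cong-≗ (λ i → sum-map-tabulate {m = M} (pair S i) id))

  forward backward : Subset M → Fin M → Fin M → ℕ
  forward  S x j = ind ((toℕ x <ᵇ toℕ j) ∧ lookup S j ∧ adj G x j)
  backward S x i = ind ((toℕ i <ᵇ toℕ x) ∧ lookup S i ∧ adj G i x)

  pair-insert : ∀ S x → lookup S x ≡ false → ∀ i j →
    pair (S [ x ]≔ true) i j ≡ pair S i j + δ x (forward S x j) i + δ x (backward S x i) j
  pair-insert S x Sx i j with i ≟ x | j ≟ x
  ... | yes refl | yes refl rewrite <ᵇ-irrefl (toℕ i) = refl
  ... | yes refl | no j≢x
    rewrite lookup∘update i S true | lookup∘update′ j≢x S true | Sx
    with toℕ i <ᵇ toℕ j
  ...   | true  = sym (+-identityʳ _)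
  ...   | false = refl
  pair-insert S x Sx i j | no i≢x | yes refl
    rewrite lookup∘update j S true | lookup∘update′ i≢x S true | Sx
    with toℕ i <ᵇ toℕ j | lookup S i
  ...   | true  | true  = refl
  ...   | true  | false = refl
  ...   | false | _     = refl
  pair-insert S x Sx i j | no i≢x | no j≢x
    rewrite lookup∘update′ i≢x S true | lookup∘update′ j≢x S true
    = sym (trans (+-identityʳ _) (+-identityʳ _))

  forward+backward : ∀ S x → lookup S x ≡ false → ∀ j →
    forward S x j + backward S x j ≡ ind (lookup S j ∧ adj G x j)
  forward+backward S x Sx j
    with toℕ x <ᵇ toℕ j | <ᵇ-reflects-< (toℕ x) (toℕ j)
       | toℕ j <ᵇ toℕ x | <ᵇ-reflects-< (toℕ j) (toℕ x)
  ... | true  | ofʸ x<j | true  | ofʸ j<x = ⊥-elim (<-asym x<j j<x)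
  ... | true  | _       | false | _       = +-identityʳ _
  ... | false | _       | true  | _       = cong (λ a → ind (lookup S j ∧ a)) (SimpleGraph.sym G j x)
  ... | false | ofⁿ x≮j | false | ofⁿ j≮x with toℕ-injective (≤-antisym (≮⇒≥ x≮j) (≮⇒≥ j≮x))
  ...   | refl rewrite Sx = refl

  edges-insert : ∀ S x → lookup S x ≡ false → edges G (S [ x ]≔ true) ≡ edges G S + deg S x
  edges-insert S x Sx = begin
    edges G (S [ x ]≔ true)
      ≡⟨ edges≡∑∑pair (S [ x ]≔ true) ⟩
    sum (λ i → sum (λ j → pair (S [ x ]≔ true) i j))
      ≡⟨ sum-cong-≗ (λ i → sum-cong-≗ (pair-insert S x Sx i)) ⟩
    sum (λ i → sum (λ j → pair S i j + δ x (fwd j) i + δ x (bwd i) j))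
      ≡⟨ trans (sum-cong-≗ (λ i → sum-distrib-+₃ (pair S i) (λ j → δ x (fwd j) i) (δ x (bwd i))))
               (sum-distrib-+₃ (λ i → sum (pair S i)) (λ i → sum (λ j → δ x (fwd j) i))
                               (λ i → sum (δ x (bwd i)))) ⟩
    sum (λ i → sum (pair S i)) + sum (λ i → sum (λ j → δ x (fwd j) i)) + sum (λ i → sum (δ x (bwd i)))
      ≡⟨ cong₂ _+_ (cong₂ _+_ (sym (edges≡∑∑pair S))
                              (trans (∑-comm (λ i j → δ x (fwd j) i)) (sum-cong-≗ (λ j → sum-δ x (fwd j)))))
                   (sum-cong-≗ (λ i → sum-δ x (bwd i))) ⟩
    edges G S + sum fwd + sum bwd
      ≡⟨ +-assoc (edges G S) _ _ ⟩
    edges G S + (sum fwd + sum bwd)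
      ≡⟨ cong (_+_ (edges G S)) (trans (sym (∑-distrib-+ fwd bwd)) (sum-cong-≗ (forward+backward S x Sx))) ⟩
    edges G S + deg S x
      ∎
    where
    open ≡-Reasoning
    fwd bwd : Fin M → ℕ
    fwd = forward S x
    bwd = backward S x

  edges-remove : ∀ S y → lookup S y ≡ true → edges G S ≡ edges G (S [ y ]≔ false) + deg (S [ y ]≔ false) y
  edges-remove S y Sy = trans (cong (edges G) (sym (p[x]≔false[x]≔true≡p S y Sy)))
                              (edges-insert (S [ y ]≔ false) y (lookup∘update y S false))

  edges-empty : ∀ S → ∣ S ∣ ≡ 0 → edges G S ≡ 0
  edges-empty S ∣S∣≡0 = trans (edges≡∑∑pair S) (sum-zero (λ i → sum-zero (pair≡0 i)))
    where
    pair≡0 : ∀ i j → pair S i j ≡ 0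
    pair≡0 i j rewrite count≡0⇒false (lookup S) (trans (sym (∣∣≡count S)) ∣S∣≡0) i
                     | ∧-zeroʳ (toℕ i <ᵇ toℕ j) = refl

  2*edges+∣∣≤∣∣² : ∀ S → 2 * edges G S + ∣ S ∣ ≤ ∣ S ∣ * ∣ S ∣
  2*edges+∣∣≤∣∣² S = bound ∣ S ∣ S refl
    where
    bound : ∀ k S → ∣ S ∣ ≡ k → 2 * edges G S + k ≤ k * k
    bound zero    S ∣S∣≡0 rewrite edges-empty S ∣S∣≡0 = z≤n
    bound (suc k) S ∣S∣≡1+k
      with y , Sy ← 0<count⇒∃true (lookup S) (subst (0 <_) (trans (sym ∣S∣≡1+k) (∣∣≡count S)) (s≤s z≤n))
      rewrite edges-remove S y Sy
      = 2[e+d]+1+k≤[1+k]² (edges G S₀) (deg S₀ y) k (bound k S₀ ∣S₀∣≡k)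
                          (subst (deg S₀ y ≤_) ∣S₀∣≡k (deg≤∣∣ S₀ y))
      where
      S₀ : Subset M
      S₀ = S [ y ]≔ false
      ∣S₀∣≡k : ∣ S₀ ∣ ≡ k
      ∣S₀∣≡k = suc-injective (trans (suc∣p[x]≔false∣≡∣p∣ S y Sy) ∣S∣≡1+k)

  edges-exchange-≤ : ∀ S {y x} → lookup S x ≡ false → lookup S y ≡ true →
    deg (S [ y ]≔ false) x ≡ ∣ S [ y ]≔ false ∣ → edges G S ≤ edges G (exchange S y x)
  edges-exchange-≤ S {y} {x} Sx Sy x-full = begin
    edges G S                 ≡⟨ edges-remove S y Sy ⟩
    edges G S₀ + deg S₀ y     ≤⟨ +-monoʳ-≤ (edges G S₀) (deg≤∣∣ S₀ y) ⟩
    edges G S₀ + ∣ S₀ ∣       ≡⟨ cong (_+_ (edges G S₀)) x-full ⟨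
    edges G S₀ + deg S₀ x     ≡⟨ edges-insert S₀ x (absent-after-remove S y Sx) ⟨
    edges G (exchange S y x)  ∎
    where
    open ≤-Reasoning
    S₀ : Subset M
    S₀ = S [ y ]≔ false

  -- Local changes of a solution

  Feasible-sym : ∀ {α A B} → Feasible G α A B → Feasible G α B A
  Feasible-sym {α} {A} {B} (A≠∅ , B≠∅ , A≢B , A∩B≤αA , A∩B≤αB) =
    B≠∅ , A≠∅ , A≢B ∘ sym ,
    subst (λ C → nat ∣ C ∣ ℚ.≤ α ℚ.* nat ∣ B ∣) (∩-comm A B) A∩B≤αB ,
    subst (λ C → nat ∣ C ∣ ℚ.≤ α ℚ.* nat ∣ A ∣) (∩-comm A B) A∩B≤αA

  Optimal-sym : ∀ {α A B} → Optimal G α A B → Optimal G α B A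
  Optimal-sym {α} {A} {B} (feasible , maximal) = Feasible-sym {α} feasible , λ W₁ W₂ W-feasible →
    subst (value G W₁ W₂ ℚ.≤_) (ℚ.+-comm (density G A) (density G B)) (maximal W₁ W₂ W-feasible)

  insert-feasible : ∀ {α} .{{_ : ℚ.NonNegative α}} {A B x} → lookup A x ≡ false → lookup B x ≡ false →
    Feasible G α A B → Feasible G α (A [ x ]≔ true) B
  insert-feasible {α} {A} {B} {x} Ax Bx (_ , B≠∅ , _ , A∩B≤αA , A∩B≤αB) =
    (x , lookup⇒[]= x A′ A′x) , B≠∅ , distinct-subsets x A′x Bx ,
    subst₂ (λ C s → nat ∣ C ∣ ℚ.≤ α ℚ.* nat s) (sym A′∩B≡A∩B) (sym (∣p[x]≔true∣≡suc∣p∣ A x Ax))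
      (ℚ.≤-trans A∩B≤αA (ℚ.*-monoˡ-≤-nonNeg α (nat-mono-≤ (n≤1+n ∣ A ∣)))) ,
    subst (λ C → nat ∣ C ∣ ℚ.≤ α ℚ.* nat ∣ B ∣) (sym A′∩B≡A∩B) A∩B≤αB
    where
    A′ : Subset M
    A′ = A [ x ]≔ true
    A′x : lookup A′ x ≡ true
    A′x = lookup∘update x A true
    A′∩B≡A∩B : A′ ∩ B ≡ A ∩ B
    A′∩B≡A∩B = p[x]≔true∩q≡p∩q A B Bx

  density-insert-≤⇒2deg+1≤∣∣ : ∀ {A x} → Nonempty A → lookup A x ≡ false →
    density G (A [ x ]≔ true) ℚ.≤ density G A → 2 * deg A x + 1 ≤ ∣ A ∣
  density-insert-≤⇒2deg+1≤∣∣ {A} {x} A≠∅ Ax density-≤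
    with k , ∣A∣≡1+k ← nonempty⇒∣∣≡suc A A≠∅ =
    subst (2 * deg A x + 1 ≤_) (sym ∣A∣≡1+k)
      (d*s≤e⇒2d+1≤s (edges G A) (deg A x) (suc k) d*s≤e
        (subst (λ s → 2 * edges G A + s ≤ s * s) ∣A∣≡1+k (2*edges+∣∣≤∣∣² A)))
    where
    d*s≤e : deg A x * suc k ≤ edges G A
    d*s≤e = [e+d]*s≤e*[1+s]⇒d*s≤e (edges G A) (deg A x) (suc k)
      (subst (λ e → e * suc k ≤ edges G A * suc (suc k)) (edges-insert A x Ax)
        (divℕ-≤⇒*-≤ (edges G (A [ x ]≔ true)) (suc k) (edges G A) k
          (subst₂ (λ s t → divℕ (edges G (A [ x ]≔ true)) s ℚ.≤ divℕ (edges G A) t)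
            (trans (∣p[x]≔true∣≡suc∣p∣ A x Ax) (cong suc ∣A∣≡1+k)) ∣A∣≡1+k density-≤)))

  optimal⇒2deg+1≤∣∣ : ∀ {α} .{{_ : ℚ.NonNegative α}} {A B x} → Optimal G α A B →
    lookup A x ≡ false → lookup B x ≡ false → 2 * deg A x + 1 ≤ ∣ A ∣
  optimal⇒2deg+1≤∣∣ {α} {A} {B} {x} (feasible , maximal) Ax Bx =
    density-insert-≤⇒2deg+1≤∣∣ (proj₁ feasible) Ax
      (ℚ-+-cancelʳ-≤ _ _ (density G B) (maximal (A [ x ]≔ true) B (insert-feasible {α} Ax Bx feasible)))

  exchange-optimal : ∀ {α A B x y} → lookup A x ≡ false → lookup B x ≡ true →
    lookup A y ≡ true → lookup B y ≡ true → deg (A [ y ]≔ false) x ≡ ∣ A [ y ]≔ false ∣ →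
    Optimal G α A B → Optimal G α (exchange A y x) B
  exchange-optimal {α} {A} {B} {x} {y} Ax Bx Ay By x-full ((_ , B≠∅ , _ , A∩B≤αA , A∩B≤αB) , maximal) =
    A′-feasible , λ W₁ W₂ W-feasible →
      ℚ.≤-trans (maximal W₁ W₂ W-feasible) (ℚ.+-monoˡ-≤ (density G B) density-≤)
    where
    A′ : Subset M
    A′ = exchange A y x
    ∣A′∣≡∣A∣ : ∣ A′ ∣ ≡ ∣ A ∣
    ∣A′∣≡∣A∣ = ∣exchange∣ A Ax Ay
    ∣A′∩B∣≡∣A∩B∣ : ∣ A′ ∩ B ∣ ≡ ∣ A ∩ B ∣
    ∣A′∩B∣≡∣A∩B∣ = trans (cong ∣_∣ (exchange-∩ A B y Bx))
      (∣exchange∣ (A ∩ B) (trans (lookup-∩ A B x) (cong (_∧ lookup B x) Ax))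
                          (trans (lookup-∩ A B y) (cong₂ _∧_ Ay By)))
    A′-feasible : Feasible G α A′ B
    A′-feasible =
      (x , lookup⇒[]= x A′ (lookup-exchange-in A y x)) , B≠∅ ,
      (distinct-subsets y By (lookup-exchange-out A (distinct-elements A Ax Ay ∘ sym)) ∘ sym) ,
      subst₂ (λ s t → nat s ℚ.≤ α ℚ.* nat t) (sym ∣A′∩B∣≡∣A∩B∣) (sym ∣A′∣≡∣A∣) A∩B≤αA ,
      subst (λ s → nat s ℚ.≤ α ℚ.* nat ∣ B ∣) (sym ∣A′∩B∣≡∣A∩B∣) A∩B≤αB
    density-≤ : density G A ℚ.≤ density G A′
    density-≤ = subst (λ s → density G A ℚ.≤ divℕ (edges G A′) s) (sym ∣A′∣≡∣A∣)
      (divℕ-monoˡ-≤ ∣ A ∣ (edges-exchange-≤ A Ax Ay x-full))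

-- The clique join

module _ {n} (GB : SimpleGraph n) where

  private
    G : SimpleGraph (n + n)
    G = cliqueJoin GB

  clique base : Fin n → Fin (n + n)
  clique i = i ↑ˡ n
  base   j = n ↑ʳ j

  clique-base-elim : ∀ {ℓ} (P : Fin (n + n) → Set ℓ) →
    (∀ i → P (clique i)) → (∀ j → P (base j)) → ∀ x → P x
  clique-base-elim P P-clique P-base x with splitAt n x in eq
  ... | inj₁ i = subst P (splitAt⁻¹-↑ˡ eq) (P-clique i)
  ... | inj₂ j = subst P (splitAt⁻¹-↑ʳ eq) (P-base j)

  clique≢base : ∀ i j → clique i ≢ base j
  clique≢base i j eq with () ← trans (sym (splitAt-↑ˡ n i n)) (trans (cong (splitAt n) eq) (splitAt-↑ʳ n n j))

  adj-clique-base : ∀ i j → adj G (clique i) (base j) ≡ true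
  adj-clique-base i j rewrite splitAt-↑ˡ n i n | splitAt-↑ʳ n n j = refl

  adj-base-clique : ∀ j i → adj G (base j) (clique i) ≡ true
  adj-base-clique j i rewrite splitAt-↑ˡ n i n | splitAt-↑ʳ n n j = refl

  adj-clique-clique : ∀ {i i′} → i ≢ i′ → adj G (clique i) (clique i′) ≡ true
  adj-clique-clique {i} {i′} i≢i′ rewrite splitAt-↑ˡ n i n | splitAt-↑ˡ n i′ n with i ≟ i′
  ... | yes i≡i′ = ⊥-elim (i≢i′ i≡i′)
  ... | no  _    = refl

  deg-clique : ∀ S i → lookup S (clique i) ≡ false → deg G S (clique i) ≡ ∣ S ∣
  deg-clique S i Sᵢ = trans (sum-cong-≗ (clique-base-elim _ clique-neighbour base-neighbour)) (sym (∣∣≡count S))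
    where
    clique-neighbour : ∀ i′ →
      ind (lookup S (clique i′) ∧ adj G (clique i) (clique i′)) ≡ ind (lookup S (clique i′))
    clique-neighbour i′ with i′ ≟ i
    ... | yes refl rewrite Sᵢ = refl
    ... | no i′≢i  rewrite adj-clique-clique (i′≢i ∘ sym) | ∧-identityʳ (lookup S (clique i′)) = refl
    base-neighbour : ∀ j → ind (lookup S (base j) ∧ adj G (clique i) (base j)) ≡ ind (lookup S (base j))
    base-neighbour j rewrite adj-clique-base i j | ∧-identityʳ (lookup S (base j)) = refl

  cliqueCount baseCount : Subset (n + n) → ℕ
  cliqueCount S = count (lookup S ∘ clique)
  baseCount   S = count (lookup S ∘ base)

  ∣∣≡cliqueCount+baseCount : ∀ S → ∣ S ∣ ≡ cliqueCount S + baseCount S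
  ∣∣≡cliqueCount+baseCount S = trans (∣∣≡count S) (sum-↑ n n (ind ∘ lookup S))

  cliqueCount≤deg-base : ∀ S j → cliqueCount S ≤ deg G S (base j)
  cliqueCount≤deg-base S j = begin
    cliqueCount S                                      ≡⟨ sum-cong-≗ (cong ind ∘ adjacent) ⟨
    sum (neighbour ∘ clique)                           ≤⟨ m≤m+n _ _ ⟩
    sum (neighbour ∘ clique) + sum (neighbour ∘ base)  ≡⟨ sum-↑ n n neighbour ⟨
    deg G S (base j)                                   ∎
    where
    open ≤-Reasoning
    neighbour : Fin (n + n) → ℕ
    neighbour x = ind (lookup S x ∧ adj G (base j) x)
    adjacent : ∀ i → lookup S (clique i) ∧ adj G (base j) (clique i) ≡ lookup S (clique i)
    adjacent i = trans (cong (lookup S (clique i) ∧_) (adj-base-clique j i)) (∧-identityʳ _)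

  cliqueCount-exchange : ∀ S {i j} → lookup S (clique i) ≡ false →
    cliqueCount (exchange S (base j) (clique i)) ≡ suc (cliqueCount S)
  cliqueCount-exchange S {i} {j} Sᵢ =
    count-insert (lookup S ∘ clique) _ Sᵢ (lookup-exchange-in S (base j) (clique i))
      (λ k k≢i → lookup-exchange-other S (k≢i ∘ ↑ˡ-injective n k i) (clique≢base k j))

  module _ {α : ℚ} .{{_ : ℚ.NonNegative α}} where

    no-uncovered-clique-vertex : ∀ {A B} i → Optimal G α A B →
      lookup A (clique i) ≡ false → lookup B (clique i) ≡ false → ⊥
    no-uncovered-clique-vertex {A} i opt Aᵢ Bᵢ =
      2*k+1≰k ∣ A ∣ (subst (λ d → 2 * d + 1 ≤ ∣ A ∣) (deg-clique A i Aᵢ)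
                          (optimal⇒2deg+1≤∣∣ G {α} opt Aᵢ Bᵢ))

    clique-covered : ∀ {A B} → Optimal G α A B → ∀ i → lookup A (clique i) ∨ lookup B (clique i) ≡ true
    clique-covered opt i = ∨-cover (no-uncovered-clique-vertex i opt)

    cliqueCount<baseCount : ∀ {A B} j → Optimal G α A B →
      lookup A (base j) ≡ false → lookup B (base j) ≡ false → cliqueCount A < baseCount A
    cliqueCount<baseCount {A} j opt Aⱼ Bⱼ = 2*c+1≤c+b⇒c<b (cliqueCount A) (baseCount A)
      (subst (2 * cliqueCount A + 1 ≤_) (∣∣≡cliqueCount+baseCount A)
        (≤-trans (+-monoˡ-≤ 1 (*-monoʳ-≤ 2 (cliqueCount≤deg-base A j)))
                 (optimal⇒2deg+1≤∣∣ G {α} opt Aⱼ Bⱼ)))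

    module _ {A B : Subset (n + n)} (j : Fin n) (opt : Optimal G α A B)
             (Aⱼ : lookup A (base j) ≡ false) (Bⱼ : lookup B (base j) ≡ false) where

      cliqueCount<n : cliqueCount A < n
      cliqueCount<n = <-≤-trans (cliqueCount<baseCount j opt Aⱼ Bⱼ) (count≤ (lookup A ∘ base))

      n<baseCount+baseCount : n < baseCount A + baseCount B
      n<baseCount+baseCount =
        ≤-<-trans (count-cover (lookup A ∘ clique) (lookup B ∘ clique) (clique-covered opt))
                  (+-mono-< (cliqueCount<baseCount j opt Aⱼ Bⱼ)
                            (cliqueCount<baseCount j (Optimal-sym G {α} opt) Bⱼ Aⱼ))

      exchange-into-clique :
        ∃ λ A′ → Optimal G α A′ B × lookup A′ (base j) ≡ false × cliqueCount A′ ≡ suc (cliqueCount A)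
      exchange-into-clique =
        let i , Aᵢ = count<⇒∃false (lookup A ∘ clique) cliqueCount<n
            j′ , Aⱼ′ , Bⱼ′ = count-overlap (lookup A ∘ base) (lookup B ∘ base) n<baseCount+baseCount
            Bᵢ : lookup B (clique i) ≡ true
            Bᵢ = subst (λ a → a ∨ lookup B (clique i) ≡ true) Aᵢ (clique-covered opt i)
            full : deg G (A [ base j′ ]≔ false) (clique i) ≡ ∣ A [ base j′ ]≔ false ∣
            full = deg-clique (A [ base j′ ]≔ false) i (absent-after-remove A (base j′) Aᵢ)
        in exchange A (base j′) (clique i) ,
           exchange-optimal G {α} Aᵢ Bᵢ Aⱼ′ Bⱼ′ full opt ,
           trans (lookup-exchange-other A (clique≢base i j ∘ sym) (distinct-elements B Bⱼ Bⱼ′)) Aⱼ ,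
           cliqueCount-exchange A Aᵢ

    -- k bounds the number of clique vertices still missing from A, hence the number of exchanges.
    no-uncovered-base-vertex : ∀ k {A B} j → n ≤ cliqueCount A + k → Optimal G α A B →
      lookup A (base j) ≡ false → lookup B (base j) ≡ false → ⊥
    no-uncovered-base-vertex zero    {A} j n≤cA opt Aⱼ Bⱼ =
      <⇒≱ (cliqueCount<n j opt Aⱼ Bⱼ) (subst (n ≤_) (+-identityʳ (cliqueCount A)) n≤cA)
    no-uncovered-base-vertex (suc k) {A} j n≤cA+1+k opt Aⱼ Bⱼ =
      let A′ , opt′ , A′ⱼ , cA′≡1+cA = exchange-into-clique j opt Aⱼ Bⱼ in
      no-uncovered-base-vertex k j
        (subst (n ≤_) (trans (+-suc (cliqueCount A) k) (cong (_+ k) (sym cA′≡1+cA))) n≤cA+1+k)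
        opt′ A′ⱼ Bⱼ

    no-uncovered-vertex : ∀ {A B} x → Optimal G α A B → lookup A x ≡ false → lookup B x ≡ false → ⊥
    no-uncovered-vertex {A} {B} =
      clique-base-elim (λ x → Optimal G α A B → lookup A x ≡ false → lookup B x ≡ false → ⊥)
        no-uncovered-clique-vertex (λ j → no-uncovered-base-vertex n j (m≤n+m n (cliqueCount A)))

corollary19 : (n : ℕ) → 2 ∣ n → (GB : SimpleGraph n) → (V₁ V₂ : Subset (n + n)) →
    Optimal (cliqueJoin GB) (+ 2 / 3) V₁ V₂ → V₁ ∪ V₂ ≡ ⊤
corollary19 n _ GB V₁ V₂ opt = ⊆-antisym ⊆⊤ (λ {x} _ → ∪-cover V₁ V₂ x (no-uncovered-vertex GB x opt))
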